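{- Let $N \ge 1$, let $G_N$ be the divisibility graph on $X_N=\{1,\dots,N\}$, let $p \le N$ be a prime and $M(p)=\lfloor N/p \rfloor$. Let $\sigma_0(m)$ denote the number of positive divisors of $m$ and $d(j,k)=\gcd(j,k)$. Then the (unnormalised) betweenness centrality of $p$ is $$x_p = \sum_{j=2}^{M(p)} \ \sum_{\substack{k=j+1 \\ j \nmid k}}^{M(p)} \frac{1}{\sigma_0\big(d(j,k)\,p\big) + \left\lfloor \frac{N}{pjk/d(j,k)} \right\rfloor}.$$
   Context: The divisibility graph $G_N$ is the simple undirected graph with vertex set $X_N=\{1,\dots,N\}$, in which two distinct vertices $i \ne j$ are adjacent if and only if $i$ divides $j$ or $j$ divides $i$ (no loops). For distinct vertices $s,t$, $g_{st}$ is the number of shortest paths between $s$ and $t$, and for a vertex $n \notin\{s,t\}$, $n^n_{st}$ is the number of those shortest paths passing through $n$. The betweenness centrality of $n$ is $x_n = \sum_{\{s,t\}} \frac{n^n_{st}}{g_{st}}$, summed over unordered pairs $\{s,t\}$ of distinct vertices of $X_N \setminus \{n\}$. $\lfloor x \rfloor$ denotes the floor of $x$; an empty sum is $0$. -}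

module Defs where

open import Data.Bool using (Bool; true; false; _∧_; _∨_; not; if_then_else_)
open import Data.Nat using (ℕ; zero; suc; _*_; _∸_; _≡ᵇ_; _<ᵇ_)
import Data.Nat as ℕ
open import Data.Nat.Divisibility using (_∣?_)
open import Data.Nat.GCD using (gcd)
open import Data.List using (List; []; _∷_; applyUpTo; concatMap; map; filterᵇ; length; foldr)
open import Data.Bool.ListAction using (any)
open import Data.Integer using (+_)
open import Data.Rational using (ℚ; 0ℚ; _/_)
import Data.Rational as ℚ
open import Relation.Nullary.Decidable using (does)
open import Data.Product using (_×_; _,_)

-- the integer interval [a, b] (empty if b < a)
fromTo : ℕ → ℕ → List ℕ
fromTo a b = applyUpTo (a ℕ.+_) (suc b ∸ a)

vertices : ℕ → List ℕ
vertices N = fromTo 1 N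

divides? : ℕ → ℕ → Bool
divides? a b = does (a ∣? b)

adj : ℕ → ℕ → Bool
adj i j = not (i ≡ᵇ j) ∧ (divides? i j ∨ divides? j i)

walks : (N k s t : ℕ) → List (List ℕ)
walks N zero    s t = if s ≡ᵇ t then (s ∷ []) ∷ [] else []
walks N (suc k) s t = concatMap (λ v → map (s ∷_) (walks N k v t)) (filterᵇ (adj s) (vertices N))

firstNonempty : (N : ℕ) → List ℕ → ℕ → ℕ → List (List ℕ)
firstNonempty N []       s t = []
firstNonempty N (k ∷ ks) s t with walks N k s t
... | []       = firstNonempty N ks s t
... | (w ∷ ws) = w ∷ ws

-- all shortest paths from s to t in G_N (a path has at most N vertices, so
-- length at most N; minimal-length walks are exactly the shortest paths)
shortestPaths : (N s t : ℕ) → List (List ℕ)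
shortestPaths N s t = firstNonempty N (upTo′ N) s t
  where
  upTo′ : ℕ → List ℕ
  upTo′ n = applyUpTo (λ i → i) (suc n)

g : (N s t : ℕ) → ℕ
g N s t = length (shortestPaths N s t)

gThrough : (N n s t : ℕ) → ℕ
gThrough N n s t = length (filterᵇ (any (n ≡ᵇ_)) (shortestPaths N s t))

-- a / b as a rational, with the convention a / 0 = 0 (never used in a degenerate way)
frac : ℕ → ℕ → ℚ
frac a zero    = 0ℚ
frac a (suc b) = + a / suc b

sumℚ : List ℚ → ℚ
sumℚ = foldr ℚ._+_ 0ℚ

-- unordered pairs {s, t} (s < t) of distinct vertices of X_N ∖ {n}
pairsAvoiding : ℕ → ℕ → List (ℕ × ℕ)
pairsAvoiding N n =
  concatMap (λ s → map (s ,_) (filterᵇ (λ t → not (t ≡ᵇ n)) (fromTo (suc s) N)))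
            (filterᵇ (λ s → not (s ≡ᵇ n)) (vertices N))

betweenness : (N n : ℕ) → ℚ
betweenness N n = sumℚ (map (λ { (s , t) → frac (gThrough N n s t) (g N s t) }) (pairsAvoiding N n))

σ₀ : ℕ → ℕ
σ₀ m = length (filterᵇ (λ d → divides? d m) (fromTo 1 m))

-- floor division with the convention a / 0 = 0 (never hit below)
divℕ : ℕ → ℕ → ℕ
divℕ a zero    = 0
divℕ a (suc b) = a ℕ./ suc b

rhs : (N p : ℕ) → ℚ
rhs N p = sumℚ (map (λ j →
            sumℚ (map (λ k →
                    frac 1 (σ₀ (gcd j k * p) ℕ.+ divℕ N (divℕ (p * j * k) (gcd j k))))
                  (filterᵇ (λ k → not (divides? j k)) (fromTo (suc j) M))))
          (fromTo 2 M))
  where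
  M : ℕ
  M = divℕ N p

-- In G_N the vertex 1 is adjacent to every other vertex, so any two vertices are at
-- distance at most 2. An adjacent pair {s, t} therefore contributes nothing, while for a
-- non-adjacent pair the shortest paths are s – v – t over the common neighbours v, and
-- n lies on one of them iff n is itself a common neighbour. The neighbours of a prime p
-- are 1 and the multiples of p, so only the pairs {pj, pk} with 2 ≤ j < k ≤ ⌊N/p⌋ and
-- j ∤ k contribute. Their common neighbours are the divisors of gcd(pj, pk) = p·gcd(j, k)
-- and the multiples of lcm(pj, pk) = pjk / gcd(j, k) up to N.

{-# OPTIONS --safe #-}
module Submission where

open import Algebra.Structures using (IsMonoid)
open import Data.Bool using (Bool; true; false; not; _∧_; _∨_; if_then_else_)
open import Data.Bool.ListAction using (any)
open import Data.Bool.Properties using (∧-zeroʳ; ∨-identityʳ; if-eta; if-∧; if-cong; if-cong-then)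
open import Data.Empty using (⊥-elim)
open import Data.List using (List; []; _∷_; _++_; map; foldr; filterᵇ; applyUpTo; concatMap; length)
open import Data.List.Properties
  using (map-applyUpTo; map-concatMap; map-cong; map-∘; filter-++; length-++; length-applyUpTo)
open import Data.Nat
  using (ℕ; zero; suc; pred; _+_; _*_; _∸_; _≤_; _<_; _≡ᵇ_; _/_; _%_; z≤n; s≤s; s≤s⁻¹; z<s; s<s;
         NonZero; ≢-nonZero; ≢-nonZero⁻¹; >-nonZero; >-nonZero⁻¹)
open import Data.Nat.Properties
open import Data.Nat.DivMod using (m≡m%n+[m/n]*n; m%n<n; m*n/n≡m; m/n*n≤m; m≥n⇒m/n>0; /-congˡ)
open import Data.Nat.Divisibility
  using (_∣_; _∣?_; ∣-refl; ∣-trans; ∣⇒≤; >⇒∤; 1∣_; 0∣⇒≡0; m∣m*n; ∣m+n∣m⇒∣n; *-monoʳ-∣; *-cancelˡ-∣)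
open import Data.Nat.GCD using (gcd; gcd[m,n]∣m; gcd[m,n]∣n; gcd-greatest; gcd[m,n]≢0; c*gcd[m,n]≡gcd[cm,cn])
open import Data.Nat.ListAction using (sum)
open import Data.Nat.LCM using (lcm; m∣lcm[m,n]; n∣lcm[m,n]; lcm-least; gcd*lcm)
open import Data.Nat.Primality using (Prime; prime⇒irreducible; prime⇒nonZero; ¬prime[0])
open import Data.Nat.Tactic.RingSolver using (solve-∀)
open import Data.Product using (_×_; _,_)
open import Data.Rational using (ℚ; 0ℚ)
import Data.Rational as ℚ using (_+_)
import Data.Rational.Properties as ℚP
open import Data.Sum using (_⊎_; inj₁; inj₂)
import Data.Sum as Sum
open import Function using (_∘_; _⇔_; mk⇔)
open import Relation.Binary.PropositionalEquality
open import Relation.Nullary using (Dec; does; ¬_; yes; no; contradiction)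
open import Relation.Nullary.Decidable using (T?; dec-true; dec-false; does-⇔; ¬?; _×-dec_; _⊎-dec_)

open import Defs

applyUpTo-+ : ∀ {A : Set} (f : ℕ → A) m n →
              applyUpTo f (m + n) ≡ applyUpTo f m ++ applyUpTo (f ∘ (m +_)) n
applyUpTo-+ f zero    n = refl
applyUpTo-+ f (suc m) n = cong (f 0 ∷_) (applyUpTo-+ (f ∘ suc) m n)

vertices-++ : ∀ {m N} → m ≤ N → vertices N ≡ vertices m ++ fromTo (suc m) N
vertices-++ {m} {N} m≤N = begin
  vertices N                        ≡⟨ cong (applyUpTo suc) (m+[n∸m]≡n m≤N) ⟨
  applyUpTo suc (m + (N ∸ m))       ≡⟨ applyUpTo-+ suc m (N ∸ m) ⟩
  vertices m ++ fromTo (suc m) N    ∎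
  where open ≡-Reasoning

fromTo-1 : ∀ {m} → 1 ≤ m → fromTo 1 m ≡ 1 ∷ fromTo 2 m
fromTo-1 {suc m} _ = refl

m<n∸o⇒o+m<n : ∀ m n o → m < n ∸ o → o + m < n
m<n∸o⇒o+m<n m n       zero    m<n   = m<n
m<n∸o⇒o+m<n m (suc n) (suc o) m<n∸o = s<s (m<n∸o⇒o+m<n m n o m<n∸o)

fromTo-index≤ : ∀ a b i → i < suc b ∸ a → a + i ≤ b
fromTo-index≤ a b i i<n = s≤s⁻¹ (m<n∸o⇒o+m<n i (suc b) a i<n)

-- Finite sums in a monoid

module MonoidSum {A : Set} {_∙_ : A → A → A} {ε : A} (isMonoid : IsMonoid _≡_ _∙_ ε) where

  open IsMonoid isMonoid using (assoc; identityˡ; identityʳ)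
  open ≡-Reasoning

  ∑ : List A → A
  ∑ = foldr _∙_ ε

  ∑-++ : ∀ xs ys → ∑ (xs ++ ys) ≡ ∑ xs ∙ ∑ ys
  ∑-++ []       ys = sym (identityˡ (∑ ys))
  ∑-++ (x ∷ xs) ys = trans (cong (x ∙_) (∑-++ xs ys)) (sym (assoc x (∑ xs) (∑ ys)))

  ∑-concatMap : ∀ {B : Set} (f : B → List A) xs → ∑ (concatMap f xs) ≡ ∑ (map (∑ ∘ f) xs)
  ∑-concatMap f []       = refl
  ∑-concatMap f (x ∷ xs) = trans (∑-++ (f x) (concatMap f xs)) (cong (∑ (f x) ∙_) (∑-concatMap f xs))

  ∑-filterᵇ : ∀ {B : Set} (f : B → A) (P : B → Bool) xs →
              ∑ (map f (filterᵇ P xs)) ≡ ∑ (map (λ x → if P x then f x else ε) xs)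
  ∑-filterᵇ f P []       = refl
  ∑-filterᵇ f P (x ∷ xs) with P x
  ... | true  = cong (f x ∙_) (∑-filterᵇ f P xs)
  ... | false = trans (∑-filterᵇ f P xs) (sym (identityˡ _))

  ∑-applyUpTo-cong : ∀ {h h′ : ℕ → A} n → (∀ i → i < n → h i ≡ h′ i) →
                     ∑ (applyUpTo h n) ≡ ∑ (applyUpTo h′ n)
  ∑-applyUpTo-cong zero    eq = refl
  ∑-applyUpTo-cong (suc n) eq =
    cong₂ _∙_ (eq 0 z<s) (∑-applyUpTo-cong n (λ i i<n → eq (suc i) (s<s i<n)))

  ∑-applyUpTo-ε : ∀ {h : ℕ → A} n → (∀ i → i < n → h i ≡ ε) → ∑ (applyUpTo h n) ≡ ε
  ∑-applyUpTo-ε zero    eq = refl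
  ∑-applyUpTo-ε (suc n) eq =
    trans (cong₂ _∙_ (eq 0 z<s) (∑-applyUpTo-ε n (λ i i<n → eq (suc i) (s<s i<n)))) (identityˡ ε)

  ∑-applyUpTo-single : ∀ {h : ℕ → A} n i₀ → i₀ < n → (∀ i → i < n → i ≢ i₀ → h i ≡ ε) →
                       ∑ (applyUpTo h n) ≡ h i₀
  ∑-applyUpTo-single {h} (suc n) zero _ eq =
    trans (cong (h 0 ∙_) (∑-applyUpTo-ε n (λ i i<n → eq (suc i) (s<s i<n) λ ()))) (identityʳ (h 0))
  ∑-applyUpTo-single (suc n) (suc i₀) (s<s i₀<n) eq =
    trans (cong₂ _∙_ (eq 0 z<s λ ())
                     (∑-applyUpTo-single n i₀ i₀<n λ i i<n i≢i₀ →
                        eq (suc i) (s<s i<n) (i≢i₀ ∘ suc-injective)))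
          (identityˡ _)

  -- Blocks of p consecutive indices; in each only the last index i, with p ∣ suc i, contributes.
  ∑-applyUpTo-multiples : ∀ p q r {h : ℕ → A} .{{_ : NonZero p}} → r < p →
    (∀ i → i < p * q + r → ¬ p ∣ suc i → h i ≡ ε) →
    ∑ (applyUpTo h (p * q + r)) ≡ ∑ (applyUpTo (λ i → h (p * i + pred p)) q)
  ∑-applyUpTo-multiples p zero r r<p van rewrite *-zeroʳ p =
    ∑-applyUpTo-ε r (λ i i<r → van i i<r (>⇒∤ (≤-<-trans i<r r<p)))
  ∑-applyUpTo-multiples p (suc q) r {h} r<p van = begin
      ∑ (applyUpTo h (p * suc q + r))
    ≡⟨ cong (∑ ∘ applyUpTo h) split ⟩
      ∑ (applyUpTo h (p + (p * q + r)))
    ≡⟨ cong ∑ (applyUpTo-+ h p (p * q + r)) ⟩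
      ∑ (applyUpTo h p ++ applyUpTo (h ∘ (p +_)) (p * q + r))
    ≡⟨ ∑-++ (applyUpTo h p) _ ⟩
      ∑ (applyUpTo h p) ∙ ∑ (applyUpTo (h ∘ (p +_)) (p * q + r))
    ≡⟨ cong₂ _∙_ firstBlock (∑-applyUpTo-multiples p q r r<p vanRest) ⟩
      h (pred p) ∙ ∑ (applyUpTo (λ i → h (p + (p * i + pred p))) q)
    ≡⟨ cong₂ _∙_ (cong (h ∘ (_+ pred p)) (*-zeroʳ p)) (∑-applyUpTo-cong q (λ i _ → cong h (shift i))) ⟨
      ∑ (applyUpTo (λ i → h (p * i + pred p)) (suc q))
    ∎
    where
    split : p * suc q + r ≡ p + (p * q + r)
    split = trans (cong (_+ r) (*-suc p q)) (+-assoc p (p * q) r)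
    shift : ∀ i → p * suc i + pred p ≡ p + (p * i + pred p)
    shift i = trans (cong (_+ pred p) (*-suc p i)) (+-assoc p (p * i) (pred p))
    pred<p : pred p < p
    pred<p = m≤pred[n]⇒suc[m]≤n ≤-refl
    firstBlock : ∑ (applyUpTo h p) ≡ h (pred p)
    firstBlock = ∑-applyUpTo-single p (pred p) pred<p λ i i<p i≢ →
      van i (subst (i <_) (sym split) (≤-trans i<p (m≤m+n p _)))
            (>⇒∤ (≤-<-trans (≤∧≢⇒< (<⇒≤pred i<p) i≢) pred<p))
    vanRest : ∀ i → i < p * q + r → ¬ p ∣ suc i → h (p + i) ≡ ε
    vanRest i i< p∤ = van (p + i) (subst (p + i <_) (sym split) (+-monoʳ-< p i<))
      (λ p∣ → p∤ (∣m+n∣m⇒∣n (subst (p ∣_) (sym (+-suc p i)) p∣) ∣-refl))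

  ∑-map-fromTo : ∀ (f : ℕ → A) a b → ∑ (map f (fromTo a b)) ≡ ∑ (applyUpTo (f ∘ (a +_)) (suc b ∸ a))
  ∑-map-fromTo f a b = cong ∑ (map-applyUpTo (a +_) f (suc b ∸ a))

  ∑-fromTo-cong : ∀ {f f′ : ℕ → A} a b → (∀ x → a ≤ x → x ≤ b → f x ≡ f′ x) →
                  ∑ (map f (fromTo a b)) ≡ ∑ (map f′ (fromTo a b))
  ∑-fromTo-cong {f} {f′} a b eq = begin
      ∑ (map f (fromTo a b))
    ≡⟨ ∑-map-fromTo f a b ⟩
      ∑ (applyUpTo (f ∘ (a +_)) (suc b ∸ a))
    ≡⟨ ∑-applyUpTo-cong (suc b ∸ a) (λ i i<n → eq (a + i) (m≤m+n a i) (fromTo-index≤ a b i i<n)) ⟩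
      ∑ (applyUpTo (f′ ∘ (a +_)) (suc b ∸ a))
    ≡⟨ ∑-map-fromTo f′ a b ⟨
      ∑ (map f′ (fromTo a b))
    ∎

  ∑-fromTo-ε : ∀ {f : ℕ → A} a b → (∀ x → a ≤ x → x ≤ b → f x ≡ ε) → ∑ (map f (fromTo a b)) ≡ ε
  ∑-fromTo-ε {f} a b van = trans (∑-map-fromTo f a b)
    (∑-applyUpTo-ε (suc b ∸ a) (λ i i<n → van (a + i) (m≤m+n a i) (fromTo-index≤ a b i i<n)))

  ∑-fromTo-single : ∀ {f : ℕ → A} a b x → a ≤ x → x ≤ b →
                    (∀ y → a ≤ y → y ≤ b → y ≢ x → f y ≡ ε) → ∑ (map f (fromTo a b)) ≡ f x
  ∑-fromTo-single {f} a b x a≤x x≤b van = begin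
      ∑ (map f (fromTo a b))
    ≡⟨ ∑-map-fromTo f a b ⟩
      ∑ (applyUpTo (f ∘ (a +_)) (suc b ∸ a))
    ≡⟨ ∑-applyUpTo-single (suc b ∸ a) (x ∸ a) (∸-monoˡ-< (s≤s x≤b) a≤x) vanIndex ⟩
      f (a + (x ∸ a))
    ≡⟨ cong f (m+[n∸m]≡n a≤x) ⟩
      f x
    ∎
    where
    vanIndex : ∀ i → i < suc b ∸ a → i ≢ x ∸ a → f (a + i) ≡ ε
    vanIndex i i<n i≢ = van (a + i) (m≤m+n a i) (fromTo-index≤ a b i i<n)
      (λ a+i≡x → i≢ (trans (sym (m+n∸m≡n a i)) (cong (_∸ a) a+i≡x)))

  ∑-fromTo-multiples : ∀ p a n {f : ℕ → A} .{{_ : NonZero p}} → a ≤ n / p →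
    (∀ x → p * a < x → x ≤ n → ¬ p ∣ x → f x ≡ ε) →
    ∑ (map f (fromTo (suc (p * a)) n)) ≡ ∑ (map (f ∘ (p *_)) (fromTo (suc a) (n / p)))
  ∑-fromTo-multiples p a n {f} a≤n/p van = begin
      ∑ (map f (fromTo (suc (p * a)) n))
    ≡⟨ ∑-map-fromTo f (suc (p * a)) n ⟩
      ∑ (applyUpTo (f ∘ (suc (p * a) +_)) (n ∸ p * a))
    ≡⟨ cong (∑ ∘ applyUpTo (f ∘ (suc (p * a) +_))) remaining ⟩
      ∑ (applyUpTo (f ∘ (suc (p * a) +_)) (p * (n / p ∸ a) + n % p))
    ≡⟨ ∑-applyUpTo-multiples p (n / p ∸ a) (n % p) (m%n<n n p) vanIndex ⟩
      ∑ (applyUpTo (λ i → f (suc (p * a) + (p * i + pred p))) (n / p ∸ a))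
    ≡⟨ ∑-applyUpTo-cong (n / p ∸ a) (λ i _ → cong f (multiple-shift p a i)) ⟩
      ∑ (applyUpTo (f ∘ (p *_) ∘ (suc a +_)) (n / p ∸ a))
    ≡⟨ ∑-map-fromTo (f ∘ (p *_)) (suc a) (n / p) ⟨
      ∑ (map (f ∘ (p *_)) (fromTo (suc a) (n / p)))
    ∎
    where
    multiple-shift : ∀ p a i .{{_ : NonZero p}} → suc (p * a + (p * i + pred p)) ≡ p * (suc a + i)
    multiple-shift (suc p′) a i = ring p′ a i
      where
      ring : ∀ p′ a i → suc (suc p′ * a + (suc p′ * i + p′)) ≡ suc p′ * (suc a + i)
      ring = solve-∀
    n≡p*[n/p]+n%p : n ≡ p * (n / p) + n % p
    n≡p*[n/p]+n%p = trans (m≡m%n+[m/n]*n n p) (trans (+-comm (n % p) _) (cong (_+ n % p) (*-comm (n / p) p)))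
    remaining : n ∸ p * a ≡ p * (n / p ∸ a) + n % p
    remaining = begin
        n ∸ p * a
      ≡⟨ cong (_∸ p * a) n≡p*[n/p]+n%p ⟩
        (p * (n / p) + n % p) ∸ p * a
      ≡⟨ +-∸-comm (n % p) (*-monoʳ-≤ p a≤n/p) ⟩
        (p * (n / p) ∸ p * a) + n % p
      ≡⟨ cong (_+ n % p) (*-distribˡ-∸ p (n / p) a) ⟨
        p * (n / p ∸ a) + n % p
      ∎
    vanIndex : ∀ i → i < p * (n / p ∸ a) + n % p → ¬ p ∣ suc i → f (suc (p * a) + i) ≡ ε
    vanIndex i i<n p∤ = van (suc (p * a + i)) (s≤s (m≤m+n (p * a) i))
      (m<n∸o⇒o+m<n i n (p * a) (subst (i <_) (sym remaining) i<n))
      (λ p∣ → p∤ (∣m+n∣m⇒∣n (subst (p ∣_) (sym (+-suc (p * a) i)) p∣) (m∣m*n a)))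

module ℕΣ = MonoidSum +-0-isMonoid
module ℚΣ = MonoidSum ℚP.+-0-isMonoid

-- Counting

indicator : Bool → ℕ
indicator b = if b then 1 else 0

count : ∀ {B : Set} → (B → Bool) → List B → ℕ
count P xs = length (filterᵇ P xs)

count≡sum : ∀ {B : Set} (P : B → Bool) xs → count P xs ≡ sum (map (indicator ∘ P) xs)
count≡sum P []       = refl
count≡sum P (x ∷ xs) with P x
... | true  = cong suc (count≡sum P xs)
... | false = count≡sum P xs

length≡count : ∀ {B : Set} (xs : List B) → length xs ≡ count (λ _ → true) xs
length≡count []       = refl
length≡count (x ∷ xs) = cong suc (length≡count xs)

count-++ : ∀ {B : Set} (P : B → Bool) xs ys → count P (xs ++ ys) ≡ count P xs + count P ys
count-++ P xs ys = trans (cong length (filter-++ (T? ∘ P) xs ys)) (length-++ (filterᵇ P xs))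

count-cong : ∀ {B : Set} {P Q : B → Bool} → (∀ x → P x ≡ Q x) → ∀ xs → count P xs ≡ count Q xs
count-cong {P = P} {Q} eq xs = begin
  count P xs                   ≡⟨ count≡sum P xs ⟩
  sum (map (indicator ∘ P) xs) ≡⟨ cong sum (map-cong (cong indicator ∘ eq) xs) ⟩
  sum (map (indicator ∘ Q) xs) ≡⟨ count≡sum Q xs ⟨
  count Q xs                   ∎
  where open ≡-Reasoning

count-∨ : ∀ {B : Set} {P Q : B → Bool} → (∀ x → P x ∧ Q x ≡ false) →
          ∀ xs → count (λ x → P x ∨ Q x) xs ≡ count P xs + count Q xs
count-∨ disjoint [] = refl
count-∨ {P = P} {Q} disjoint (x ∷ xs) with P x | Q x | disjoint x
... | true  | false | _ = cong suc (count-∨ disjoint xs)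
... | false | true  | _ = trans (cong suc (count-∨ disjoint xs)) (sym (+-suc _ _))
... | false | false | _ = count-∨ disjoint xs

count-singleton : ∀ {B : Set} (P : B → Bool) x → count P (x ∷ []) ≡ indicator (P x)
count-singleton P x = trans (count≡sum P (x ∷ [])) (+-identityʳ _)

count-divisors : ∀ {d N} → 1 ≤ d → d ≤ N → count (λ v → divides? v d) (vertices N) ≡ σ₀ d
count-divisors {d} {N} 1≤d d≤N = begin
    count divisor (vertices N)
  ≡⟨ cong (count divisor) (vertices-++ d≤N) ⟩
    count divisor (vertices d ++ fromTo (suc d) N)
  ≡⟨ count-++ divisor (vertices d) (fromTo (suc d) N) ⟩
    σ₀ d + count divisor (fromTo (suc d) N)
  ≡⟨ cong (σ₀ d +_) (trans (count≡sum divisor (fromTo (suc d) N)) (ℕΣ.∑-fromTo-ε (suc d) N λ v d<v _ →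
       cong indicator (dec-false (v ∣? d) (>⇒∤ d<v)))) ⟩
    σ₀ d + 0
  ≡⟨ +-identityʳ (σ₀ d) ⟩
    σ₀ d
  ∎
  where
  open ≡-Reasoning
  divisor : ℕ → Bool
  divisor v = divides? v d
  instance
    d≢0 : NonZero d
    d≢0 = >-nonZero 1≤d

count-multiples : ∀ L N → count (divides? L) (vertices N) ≡ divℕ N L
count-multiples zero N = trans (count≡sum _ (vertices N)) (ℕΣ.∑-fromTo-ε 1 N λ v 1≤v _ →
  cong indicator (dec-false (0 ∣? v) (λ 0∣v → contradiction (0∣⇒≡0 0∣v) (≢-nonZero⁻¹ v {{>-nonZero 1≤v}}))))
count-multiples L@(suc _) N = begin
    count (divides? L) (vertices N)
  ≡⟨ count≡sum (divides? L) (vertices N) ⟩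
    sum (map multiple (fromTo 1 N))
  ≡⟨ cong (λ a → sum (map multiple (fromTo (suc a) N))) (*-zeroʳ L) ⟨
    sum (map multiple (fromTo (suc (L * 0)) N))
  ≡⟨ ℕΣ.∑-fromTo-multiples L 0 N z≤n (λ x _ _ L∤x → cong indicator (dec-false (L ∣? x) L∤x)) ⟩
    sum (map (multiple ∘ (L *_)) (fromTo 1 (N / L)))
  ≡⟨ ℕΣ.∑-fromTo-cong 1 (N / L) (λ y _ _ → cong indicator (dec-true (L ∣? (L * y)) (m∣m*n y))) ⟩
    sum (map (indicator ∘ (λ _ → true)) (fromTo 1 (N / L)))
  ≡⟨ trans (length≡count (fromTo 1 (N / L))) (count≡sum _ (fromTo 1 (N / L))) ⟨
    length (fromTo 1 (N / L))
  ≡⟨ length-applyUpTo suc (N / L) ⟩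
    N / L
  ∎
  where
  open ≡-Reasoning
  multiple : ℕ → ℕ
  multiple = indicator ∘ divides? L

Adjacent : ℕ → ℕ → Set
Adjacent i j = i ≢ j × (i ∣ j ⊎ j ∣ i)

-- `adj i j` is definitionally `does (adjacent? i j)`.
adjacent? : ∀ i j → Dec (Adjacent i j)
adjacent? i j = ¬? (i ≟ j) ×-dec (i ∣? j ⊎-dec j ∣? i)

adj-true : ∀ {i j} → Adjacent i j → adj i j ≡ true
adj-true {i} {j} = dec-true (adjacent? i j)

adj-false : ∀ {i j} → ¬ Adjacent i j → adj i j ≡ false
adj-false {i} {j} = dec-false (adjacent? i j)

Adjacent-sym : ∀ {i j} → Adjacent i j → Adjacent j i
Adjacent-sym (i≢j , i∣j⊎j∣i) = i≢j ∘ sym , Sum.swap i∣j⊎j∣i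

adj-sym : ∀ i j → adj i j ≡ adj j i
adj-sym i j = does-⇔ (mk⇔ Adjacent-sym Adjacent-sym) (adjacent? i j) (adjacent? j i)

adj-1ˡ : ∀ {x} → x ≢ 1 → adj 1 x ≡ true
adj-1ˡ {x} x≢1 = adj-true (x≢1 ∘ sym , inj₁ (1∣ x))

adj-1ʳ : ∀ {x} → x ≢ 1 → adj x 1 ≡ true
adj-1ʳ {x} x≢1 = trans (adj-sym x 1) (adj-1ˡ x≢1)

nonadjacent⇒≢1 : ∀ {s t} → s ≢ t → adj s t ≡ false → s ≢ 1
nonadjacent⇒≢1 s≢t st refl = contradiction (trans (sym st) (adj-1ˡ (s≢t ∘ sym))) λ ()

adj-prime : ∀ {p x} → Prime p → x ≢ 1 → ¬ p ∣ x → adj x p ≡ false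
adj-prime p-prime x≢1 p∤x = adj-false λ where
  (x≢p , inj₁ x∣p) → Sum.[ x≢1 , x≢p ] (prime⇒irreducible p-prime x∣p)
  (_   , inj₂ p∣x) → p∤x p∣x

-- Shortest paths in the divisibility graph

≡ᵇ-refl : ∀ n → (n ≡ᵇ n) ≡ true
≡ᵇ-refl n = dec-true (n ≟ n) refl

≢⇒≡ᵇ-false : ∀ {m n} → m ≢ n → (m ≡ᵇ n) ≡ false
≢⇒≡ᵇ-false {m} {n} = dec-false (m ≟ n)

if-not-≡ᵇ : ∀ {A : Set} {m n} {x y : A} → m ≢ n → (if not (m ≡ᵇ n) then x else y) ≡ x
if-not-≡ᵇ m≢n = if-cong (cong not (≢⇒≡ᵇ-false m≢n))

walks-zero-≢ : ∀ N {v t} → v ≢ t → walks N 0 v t ≡ []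
walks-zero-≢ N v≢t rewrite ≢⇒≡ᵇ-false v≢t = refl

walks-zero-refl : ∀ N t → walks N 0 t t ≡ (t ∷ []) ∷ []
walks-zero-refl N t rewrite ≡ᵇ-refl t = refl

count-walks-suc : ∀ N k s t (Q : List ℕ → Bool) →
  count Q (walks N (suc k) s t)
    ≡ sum (map (λ v → if adj s v then count (Q ∘ (s ∷_)) (walks N k v t) else 0) (vertices N))
count-walks-suc N k s t Q = begin
    count Q (concatMap extend firstSteps)
  ≡⟨ count≡sum Q (concatMap extend firstSteps) ⟩
    sum (map (indicator ∘ Q) (concatMap extend firstSteps))
  ≡⟨ cong sum (map-concatMap (indicator ∘ Q) extend firstSteps) ⟩
    sum (concatMap (map (indicator ∘ Q) ∘ extend) firstSteps)
  ≡⟨ ℕΣ.∑-concatMap (map (indicator ∘ Q) ∘ extend) firstSteps ⟩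
    sum (map (sum ∘ map (indicator ∘ Q) ∘ extend) firstSteps)
  ≡⟨ ℕΣ.∑-filterᵇ (sum ∘ map (indicator ∘ Q) ∘ extend) (adj s) (vertices N) ⟩
    sum (map (λ v → if adj s v then sum (map (indicator ∘ Q) (extend v)) else 0) (vertices N))
  ≡⟨ cong sum (map-cong (λ v → if-cong-then (adj s v) (extended v)) (vertices N)) ⟩
    sum (map (λ v → if adj s v then count (Q ∘ (s ∷_)) (walks N k v t) else 0) (vertices N))
  ∎
  where
  open ≡-Reasoning
  firstSteps : List ℕ
  firstSteps = filterᵇ (adj s) (vertices N)
  extend : ℕ → List (List ℕ)
  extend v = map (s ∷_) (walks N k v t)
  extended : ∀ v → sum (map (indicator ∘ Q) (extend v)) ≡ count (Q ∘ (s ∷_)) (walks N k v t)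
  extended v = trans (cong sum (sym (map-∘ (walks N k v t)))) (sym (count≡sum (Q ∘ (s ∷_)) (walks N k v t)))

count-walks-one : ∀ N s t (Q : List ℕ → Bool) → 1 ≤ t → t ≤ N →
  count Q (walks N 1 s t) ≡ (if adj s t then indicator (Q (s ∷ t ∷ [])) else 0)
count-walks-one N s t Q 1≤t t≤N = begin
    count Q (walks N 1 s t)
  ≡⟨ count-walks-suc N 0 s t Q ⟩
    sum (map (λ v → if adj s v then count (Q ∘ (s ∷_)) (walks N 0 v t) else 0) (vertices N))
  ≡⟨ ℕΣ.∑-fromTo-single 1 N t 1≤t t≤N (λ v _ _ v≢t →
       trans (if-cong-then (adj s v) (cong (count _) (walks-zero-≢ N v≢t))) (if-eta (adj s v))) ⟩
    (if adj s t then count (Q ∘ (s ∷_)) (walks N 0 t t) else 0)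
  ≡⟨ if-cong-then (adj s t) (trans (cong (count (Q ∘ (s ∷_))) (walks-zero-refl N t))
                                   (count-singleton (Q ∘ (s ∷_)) (t ∷ []))) ⟩
    (if adj s t then indicator (Q (s ∷ t ∷ [])) else 0)
  ∎
  where open ≡-Reasoning

count-walks-two : ∀ N s t (Q : List ℕ → Bool) → 1 ≤ t → t ≤ N →
  count Q (walks N 2 s t)
    ≡ sum (map (λ v → if adj s v ∧ adj v t then indicator (Q (s ∷ v ∷ t ∷ [])) else 0) (vertices N))
count-walks-two N s t Q 1≤t t≤N = trans (count-walks-suc N 1 s t Q) (cong sum (map-cong (λ v →
  trans (if-cong-then (adj s v) (count-walks-one N v t _ 1≤t t≤N)) (sym (if-∧ (adj s v)))) (vertices N)))

firstNonempty-skip : ∀ N k ks s t → length (walks N k s t) ≡ 0 →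
                     firstNonempty N (k ∷ ks) s t ≡ firstNonempty N ks s t
firstNonempty-skip N k ks s t none with walks N k s t
... | [] = refl

firstNonempty-hit : ∀ N k ks s t → 0 < length (walks N k s t) →
                    firstNonempty N (k ∷ ks) s t ≡ walks N k s t
firstNonempty-hit N k ks s t some with walks N k s t
... | _ ∷ _ = refl

shortestPaths-adjacent : ∀ {N s t} → s ≢ t → 1 ≤ t → t ≤ N → adj s t ≡ true →
                         shortestPaths N s t ≡ walks N 1 s t
shortestPaths-adjacent {zero} _ () z≤n _
shortestPaths-adjacent {N@(suc _)} {s} {t} s≢t 1≤t t≤N st =
  trans (firstNonempty-skip N 0 _ s t (cong length (walks-zero-≢ N s≢t)))
        (firstNonempty-hit N 1 _ s t (≤-reflexive (sym oneWalk)))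
  where
  oneWalk : length (walks N 1 s t) ≡ 1
  oneWalk = trans (length≡count (walks N 1 s t))
                  (trans (count-walks-one N s t (λ _ → true) 1≤t t≤N) (if-cong st))

shortestPaths-nonadjacent : ∀ {N s t} → s ≢ t → 1 ≤ t → t ≤ N → adj s t ≡ false →
                            shortestPaths N s t ≡ walks N 2 s t
shortestPaths-nonadjacent {zero} _ () z≤n _
shortestPaths-nonadjacent {suc zero} {s} {t} s≢t 1≤t t≤N st =
  ⊥-elim (nonadjacent⇒≢1 (s≢t ∘ sym) (trans (adj-sym t s) st) (≤-antisym t≤N 1≤t))
shortestPaths-nonadjacent {N@(suc (suc _))} {s} {t} s≢t 1≤t t≤N st =
  trans (firstNonempty-skip N 0 _ s t (cong length (walks-zero-≢ N s≢t)))
        (trans (firstNonempty-skip N 1 _ s t noWalk)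
               (firstNonempty-hit N 2 _ s t (subst (0 <_) (sym (length≡count (walks N 2 s t))) walkVia1)))
  where
  noWalk : length (walks N 1 s t) ≡ 0
  noWalk = trans (length≡count (walks N 1 s t))
                 (trans (count-walks-one N s t (λ _ → true) 1≤t t≤N) (if-cong st))
  walkVia1 : 0 < count (λ _ → true) (walks N 2 s t)
  walkVia1 rewrite count-walks-two N s t (λ _ → true) 1≤t t≤N
                 | adj-1ʳ (nonadjacent⇒≢1 s≢t st)
                 | adj-1ˡ (nonadjacent⇒≢1 (s≢t ∘ sym) (trans (adj-sym t s) st)) = z<s

visits : ℕ → List ℕ → Bool
visits n = any (n ≡ᵇ_)

visits-∷ʳ : ∀ {n t} → n ≢ t → ∀ xs → visits n (xs ++ t ∷ []) ≡ visits n xs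
visits-∷ʳ n≢t []       = cong (_∨ false) (≢⇒≡ᵇ-false n≢t)
visits-∷ʳ n≢t (x ∷ xs) = cong (_ ∨_) (visits-∷ʳ n≢t xs)

visits-interior : ∀ {n s t} → n ≢ s → n ≢ t → ∀ xs → visits n (s ∷ xs ++ t ∷ []) ≡ visits n xs
visits-interior n≢s n≢t xs = cong₂ _∨_ (≢⇒≡ᵇ-false n≢s) (visits-∷ʳ n≢t xs)

gThrough-adjacent : ∀ {N n s t} → n ≢ s → n ≢ t → s ≢ t → 1 ≤ t → t ≤ N → adj s t ≡ true →
                    gThrough N n s t ≡ 0
gThrough-adjacent {N} {n} {s} {t} n≢s n≢t s≢t 1≤t t≤N st = begin
    count (visits n) (shortestPaths N s t)
  ≡⟨ cong (count _) (shortestPaths-adjacent s≢t 1≤t t≤N st) ⟩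
    count (visits n) (walks N 1 s t)
  ≡⟨ count-walks-one N s t _ 1≤t t≤N ⟩
    (if adj s t then indicator (visits n (s ∷ t ∷ [])) else 0)
  ≡⟨ trans (if-cong st) (cong indicator (visits-interior n≢s n≢t [])) ⟩
    0
  ∎
  where open ≡-Reasoning

gThrough-nonadjacent : ∀ {N n s t} → 1 ≤ n → n ≤ N → n ≢ s → n ≢ t → s ≢ t → 1 ≤ t → t ≤ N →
                       adj s t ≡ false → gThrough N n s t ≡ indicator (adj s n ∧ adj n t)
gThrough-nonadjacent {N} {n} {s} {t} 1≤n n≤N n≢s n≢t s≢t 1≤t t≤N st = begin
    count (visits n) (shortestPaths N s t)
  ≡⟨ cong (count _) (shortestPaths-nonadjacent s≢t 1≤t t≤N st) ⟩
    count (visits n) (walks N 2 s t)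
  ≡⟨ count-walks-two N s t _ 1≤t t≤N ⟩
    sum (map (λ v → if adj s v ∧ adj v t then indicator (visits n (s ∷ v ∷ t ∷ [])) else 0) (vertices N))
  ≡⟨ ℕΣ.∑-fromTo-single 1 N n 1≤n n≤N (λ v _ _ v≢n →
       trans (if-cong-then (adj s v ∧ adj v t) (cong indicator (trans (through v) (≢⇒≡ᵇ-false (v≢n ∘ sym)))))
             (if-eta (adj s v ∧ adj v t))) ⟩
    (if adj s n ∧ adj n t then indicator (visits n (s ∷ n ∷ t ∷ [])) else 0)
  ≡⟨ if-cong-then (adj s n ∧ adj n t) (cong indicator (trans (through n) (≡ᵇ-refl n))) ⟩
    indicator (adj s n ∧ adj n t)
  ∎
  where
  open ≡-Reasoning
  through : ∀ v → visits n (s ∷ v ∷ t ∷ []) ≡ (n ≡ᵇ v)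
  through v = trans (visits-interior n≢s n≢t (v ∷ [])) (∨-identityʳ _)

commonNeighbours : ℕ → ℕ → ℕ → ℕ
commonNeighbours N s t = count (λ v → adj s v ∧ adj v t) (vertices N)

g-nonadjacent : ∀ {N s t} → s ≢ t → 1 ≤ t → t ≤ N → adj s t ≡ false → g N s t ≡ commonNeighbours N s t
g-nonadjacent {N} {s} {t} s≢t 1≤t t≤N st = begin
    length (shortestPaths N s t)
  ≡⟨ cong length (shortestPaths-nonadjacent s≢t 1≤t t≤N st) ⟩
    length (walks N 2 s t)
  ≡⟨ length≡count (walks N 2 s t) ⟩
    count (λ _ → true) (walks N 2 s t)
  ≡⟨ count-walks-two N s t _ 1≤t t≤N ⟩
    sum (map (λ v → indicator (adj s v ∧ adj v t)) (vertices N))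
  ≡⟨ count≡sum _ (vertices N) ⟨
    commonNeighbours N s t
  ∎
  where open ≡-Reasoning

-- Pair dependencies

dependency : ℕ → ℕ → ℕ → ℕ → ℚ
dependency N n s t = frac (gThrough N n s t) (g N s t)

frac-0 : ∀ m → frac 0 m ≡ 0ℚ
frac-0 zero    = refl
frac-0 (suc m) = ℚP.0/n≡0 (suc m)

frac-indicator : ∀ b m → frac (indicator b) m ≡ (if b then frac 1 m else 0ℚ)
frac-indicator true  m = refl
frac-indicator false m = frac-0 m

dependency-adjacent : ∀ {N n s t} → n ≢ s → n ≢ t → s ≢ t → 1 ≤ t → t ≤ N → adj s t ≡ true →
                      dependency N n s t ≡ 0ℚ
dependency-adjacent {N} {n} {s} {t} n≢s n≢t s≢t 1≤t t≤N st =
  trans (cong (λ m → frac m (g N s t)) (gThrough-adjacent n≢s n≢t s≢t 1≤t t≤N st)) (frac-0 (g N s t))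

dependency-nonadjacent : ∀ {N n s t} → 1 ≤ n → n ≤ N → n ≢ s → n ≢ t → s ≢ t → 1 ≤ t → t ≤ N →
  adj s t ≡ false → dependency N n s t ≡ (if adj s n ∧ adj n t then frac 1 (commonNeighbours N s t) else 0ℚ)
dependency-nonadjacent {N} {n} {s} {t} 1≤n n≤N n≢s n≢t s≢t 1≤t t≤N st =
  trans (cong₂ frac (gThrough-nonadjacent 1≤n n≤N n≢s n≢t s≢t 1≤t t≤N st) (g-nonadjacent s≢t 1≤t t≤N st))
        (frac-indicator (adj s n ∧ adj n t) (commonNeighbours N s t))

common-neighbour⇔ : ∀ {s t} → ¬ s ∣ t → ¬ t ∣ s →
                    ∀ v → (Adjacent s v × Adjacent v t) ⇔ (v ∣ gcd s t ⊎ lcm s t ∣ v)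
common-neighbour⇔ {s} {t} s∤t t∤s v = mk⇔ to from
  where
  to : Adjacent s v × Adjacent v t → v ∣ gcd s t ⊎ lcm s t ∣ v
  to ((_ , inj₁ s∣v) , (_ , inj₁ v∣t)) = contradiction (∣-trans s∣v v∣t) s∤t
  to ((_ , inj₁ s∣v) , (_ , inj₂ t∣v)) = inj₂ (lcm-least s∣v t∣v)
  to ((_ , inj₂ v∣s) , (_ , inj₁ v∣t)) = inj₁ (gcd-greatest v∣s v∣t)
  to ((_ , inj₂ v∣s) , (_ , inj₂ t∣v)) = contradiction (∣-trans t∣v v∣s) t∤s
  from : v ∣ gcd s t ⊎ lcm s t ∣ v → Adjacent s v × Adjacent v t
  from (inj₁ v∣gcd) =
    ((λ s≡v → s∤t (subst (_∣ t) (sym s≡v) v∣t)) , inj₂ v∣s) ,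
    ((λ v≡t → t∤s (subst (_∣ s) v≡t v∣s)) , inj₁ v∣t)
    where
    v∣s : v ∣ s
    v∣s = ∣-trans v∣gcd (gcd[m,n]∣m s t)
    v∣t : v ∣ t
    v∣t = ∣-trans v∣gcd (gcd[m,n]∣n s t)
  from (inj₂ lcm∣v) =
    ((λ s≡v → t∤s (subst (t ∣_) (sym s≡v) t∣v)) , inj₁ s∣v) ,
    ((λ v≡t → s∤t (subst (s ∣_) v≡t s∣v)) , inj₂ t∣v)
    where
    s∣v : s ∣ v
    s∣v = ∣-trans (m∣lcm[m,n] s t) lcm∣v
    t∣v : t ∣ v
    t∣v = ∣-trans (n∣lcm[m,n] s t) lcm∣v

commonNeighbours-incomparable : ∀ {N s t} → 1 ≤ s → s ≤ N → ¬ s ∣ t → ¬ t ∣ s →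
                                commonNeighbours N s t ≡ σ₀ (gcd s t) + divℕ N (lcm s t)
commonNeighbours-incomparable {N} {s} {t} 1≤s s≤N s∤t t∤s = begin
    count (λ v → adj s v ∧ adj v t) (vertices N)
  ≡⟨ count-cong (λ v → does-⇔ (common-neighbour⇔ s∤t t∤s v)
                               (adjacent? s v ×-dec adjacent? v t) (v ∣? gcd s t ⊎-dec lcm s t ∣? v)) (vertices N) ⟩
    count (λ v → divides? v (gcd s t) ∨ divides? (lcm s t) v) (vertices N)
  ≡⟨ count-∨ (λ v → dec-false (v ∣? gcd s t ×-dec lcm s t ∣? v) λ (v∣gcd , lcm∣v) →
       t∤s (∣-trans (∣-trans (n∣lcm[m,n] s t) lcm∣v) (∣-trans v∣gcd (gcd[m,n]∣m s t)))) (vertices N) ⟩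
    count (λ v → divides? v (gcd s t)) (vertices N) + count (divides? (lcm s t)) (vertices N)
  ≡⟨ cong₂ _+_ (count-divisors 1≤gcd (≤-trans (∣⇒≤ (gcd[m,n]∣m s t)) s≤N)) (count-multiples (lcm s t) N) ⟩
    σ₀ (gcd s t) + divℕ N (lcm s t)
  ∎
  where
  open ≡-Reasoning
  instance
    s≢0 : NonZero s
    s≢0 = >-nonZero 1≤s
  1≤gcd : 1 ≤ gcd s t
  1≤gcd = n≢0⇒n>0 (gcd[m,n]≢0 s t (inj₁ (≢-nonZero⁻¹ s)))

gcd-*ˡ : ∀ p j k → gcd (p * j) (p * k) ≡ gcd j k * p
gcd-*ˡ p j k = trans (sym (c*gcd[m,n]≡gcd[cm,cn] p j k)) (*-comm p (gcd j k))

divℕ≡/ : ∀ m n .{{_ : NonZero n}} → divℕ m n ≡ m / n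
divℕ≡/ m (suc n) = refl

lcm-*ˡ : ∀ p j k .{{_ : NonZero p}} .{{_ : NonZero j}} → lcm (p * j) (p * k) ≡ divℕ (p * j * k) (gcd j k)
lcm-*ˡ p j k = begin
    L
  ≡⟨ m*n/n≡m L d ⟨
    L * d / d
  ≡⟨ /-congˡ {o = d} (trans (*-comm L d) dL≡pjk) ⟩
    p * j * k / d
  ≡⟨ divℕ≡/ (p * j * k) d ⟨
    divℕ (p * j * k) d
  ∎
  where
  open ≡-Reasoning
  d : ℕ
  d = gcd j k
  L : ℕ
  L = lcm (p * j) (p * k)
  instance
    d≢0 : NonZero d
    d≢0 = ≢-nonZero (gcd[m,n]≢0 j k (inj₁ (≢-nonZero⁻¹ j)))
  rearrange : ∀ p j k → p * j * (p * k) ≡ p * (p * j * k)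
  rearrange = solve-∀
  dL≡pjk : d * L ≡ p * j * k
  dL≡pjk = *-cancelˡ-≡ (d * L) (p * j * k) p (begin
    p * (d * L)          ≡⟨ *-assoc p d L ⟨
    p * d * L            ≡⟨ cong (_* L) (c*gcd[m,n]≡gcd[cm,cn] p j k) ⟩
    gcd (p * j) (p * k) * L ≡⟨ gcd*lcm (p * j) (p * k) ⟩
    p * j * (p * k)      ≡⟨ rearrange p j k ⟩
    p * (p * j * k)      ∎)

pairContribution : ℕ → ℕ → ℕ → ℕ → ℚ
pairContribution N p j k = frac 1 (σ₀ (gcd j k * p) + divℕ N (divℕ (p * j * k) (gcd j k)))

-- p * j and p * k are both adjacent to p, and adjacent to each other exactly when j ∣ k.
dependency-multiples : ∀ {N p j k} .{{_ : NonZero p}} → 2 ≤ j → j < k → p * k ≤ N →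
  dependency N p (p * j) (p * k) ≡ (if not (divides? j k) then pairContribution N p j k else 0ℚ)
dependency-multiples {N} {p} {j} {k} 2≤j j<k pk≤N = byDivisibility (j ∣? k)
  where
  open ≡-Reasoning
  instance
    j≢0 : NonZero j
    j≢0 = >-nonZero (≤-trans (s≤s z≤n) 2≤j)
  p<pj : p < p * j
  p<pj = m<m*n p j 2≤j
  pj<pk : p * j < p * k
  pj<pk = *-monoʳ-< p j<k
  p≢pj : p ≢ p * j
  p≢pj = <⇒≢ p<pj
  p≢pk : p ≢ p * k
  p≢pk = <⇒≢ (<-trans p<pj pj<pk)
  pj≢pk : p * j ≢ p * k
  pj≢pk = <⇒≢ pj<pk
  1≤p : 1 ≤ p
  1≤p = >-nonZero⁻¹ p
  1≤pj : 1 ≤ p * j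
  1≤pj = ≤-trans 1≤p (<⇒≤ p<pj)
  1≤pk : 1 ≤ p * k
  1≤pk = ≤-trans 1≤pj (<⇒≤ pj<pk)
  instance
    pj≢0 : NonZero (p * j)
    pj≢0 = >-nonZero 1≤pj
  pathThroughP : adj (p * j) p ∧ adj p (p * k) ≡ true
  pathThroughP = cong₂ _∧_ (adj-true (p≢pj ∘ sym , inj₂ (m∣m*n j))) (adj-true (p≢pk , inj₁ (m∣m*n k)))
  byDivisibility : (j∣?k : Dec (j ∣ k)) →
    dependency N p (p * j) (p * k) ≡ (if not (does j∣?k) then pairContribution N p j k else 0ℚ)
  byDivisibility (yes j∣k) =
    dependency-adjacent p≢pj p≢pk pj≢pk 1≤pk pk≤N (adj-true (pj≢pk , inj₁ (*-monoʳ-∣ p j∣k)))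
  byDivisibility (no j∤k) = begin
      dependency N p (p * j) (p * k)
    ≡⟨ dependency-nonadjacent 1≤p (≤-trans (<⇒≤ (<-trans p<pj pj<pk)) pk≤N) p≢pj p≢pk pj≢pk 1≤pk pk≤N
         (adj-false λ { (_ , inj₁ pj∣pk) → j∤k (*-cancelˡ-∣ p pj∣pk) ; (_ , inj₂ pk∣pj) → >⇒∤ pj<pk pk∣pj }) ⟩
      (if adj (p * j) p ∧ adj p (p * k) then frac 1 (commonNeighbours N (p * j) (p * k)) else 0ℚ)
    ≡⟨ if-cong pathThroughP ⟩
      frac 1 (commonNeighbours N (p * j) (p * k))
    ≡⟨ cong (frac 1) (commonNeighbours-incomparable 1≤pj (≤-trans (<⇒≤ pj<pk) pk≤N)
                        (j∤k ∘ *-cancelˡ-∣ p) (>⇒∤ pj<pk)) ⟩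
      frac 1 (σ₀ (gcd (p * j) (p * k)) + divℕ N (lcm (p * j) (p * k)))
    ≡⟨ cong (frac 1) (cong₂ _+_ (cong σ₀ (gcd-*ˡ p j k)) (cong (divℕ N) (lcm-*ˡ p j k))) ⟩
      pairContribution N p j k
    ∎

dependencySum : ℕ → ℕ → ℕ → ℚ
dependencySum N n s = sumℚ (map (λ t → if not (t ≡ᵇ n) then dependency N n s t else 0ℚ) (fromTo (suc s) N))

betweenness-as-double-sum : ∀ N n →
  betweenness N n ≡ sumℚ (map (λ s → if not (s ≡ᵇ n) then dependencySum N n s else 0ℚ) (vertices N))
betweenness-as-double-sum N n = begin
    sumℚ (map δ (concatMap pairsFrom sources))
  ≡⟨ cong sumℚ (map-concatMap δ pairsFrom sources) ⟩
    sumℚ (concatMap (map δ ∘ pairsFrom) sources)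
  ≡⟨ ℚΣ.∑-concatMap (map δ ∘ pairsFrom) sources ⟩
    sumℚ (map (sumℚ ∘ map δ ∘ pairsFrom) sources)
  ≡⟨ ℚΣ.∑-filterᵇ (sumℚ ∘ map δ ∘ pairsFrom) avoids (vertices N) ⟩
    sumℚ (map (λ s → if avoids s then sumℚ (map δ (pairsFrom s)) else 0ℚ) (vertices N))
  ≡⟨ cong sumℚ (map-cong (λ s → if-cong-then (avoids s) (row s)) (vertices N)) ⟩
    sumℚ (map (λ s → if avoids s then dependencySum N n s else 0ℚ) (vertices N))
  ∎
  where
  open ≡-Reasoning
  avoids : ℕ → Bool
  avoids x = not (x ≡ᵇ n)
  sources : List ℕ
  sources = filterᵇ avoids (vertices N)
  δ : ℕ × ℕ → ℚ
  δ (s , t) = dependency N n s t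
  pairsFrom : ℕ → List (ℕ × ℕ)
  pairsFrom s = map (s ,_) (filterᵇ avoids (fromTo (suc s) N))
  row : ∀ s → sumℚ (map δ (pairsFrom s)) ≡ dependencySum N n s
  row s = trans (cong sumℚ (sym (map-∘ (filterᵇ avoids (fromTo (suc s) N)))))
                (ℚΣ.∑-filterᵇ (dependency N n s) avoids (fromTo (suc s) N))

-- The betweenness of a prime

module _ {N p : ℕ} (p-prime : Prime p) (p≤N : p ≤ N) where

  private instance
    p≢0 : NonZero p
    p≢0 = prime⇒nonZero p-prime

  dependency-off-multiples : ∀ {s t} → 1 ≤ s → s < t → t ≤ N → s ≢ p → t ≢ p → ¬ p ∣ s ⊎ ¬ p ∣ t →
                             dependency N p s t ≡ 0ℚ
  dependency-off-multiples {s} {t} 1≤s s<t t≤N s≢p t≢p p∤s⊎p∤t = byAdjacency (adj s t) refl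
    where
    s≢t : s ≢ t
    s≢t = <⇒≢ s<t
    1≤t : 1 ≤ t
    1≤t = ≤-trans 1≤s (<⇒≤ s<t)
    t≢1 : t ≢ 1
    t≢1 t≡1 = <⇒≱ (subst (s <_) t≡1 s<t) 1≤s
    noPathThroughP : adj s t ≡ false → ¬ p ∣ s ⊎ ¬ p ∣ t → adj s p ∧ adj p t ≡ false
    noPathThroughP st (inj₁ p∤s) = cong (_∧ adj p t) (adj-prime p-prime (nonadjacent⇒≢1 s≢t st) p∤s)
    noPathThroughP st (inj₂ p∤t) =
      trans (cong (adj s p ∧_) (trans (adj-sym p t) (adj-prime p-prime t≢1 p∤t))) (∧-zeroʳ (adj s p))
    byAdjacency : ∀ b → adj s t ≡ b → dependency N p s t ≡ 0ℚ
    byAdjacency true  st = dependency-adjacent (s≢p ∘ sym) (t≢p ∘ sym) s≢t 1≤t t≤N st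
    byAdjacency false st =
      trans (dependency-nonadjacent (>-nonZero⁻¹ p) p≤N (s≢p ∘ sym) (t≢p ∘ sym) s≢t 1≤t t≤N st)
            (if-cong (noPathThroughP st p∤s⊎p∤t))

  dependencySum-off-multiples : ∀ {s} → 1 ≤ s → ¬ p ∣ s → dependencySum N p s ≡ 0ℚ
  dependencySum-off-multiples {s} 1≤s p∤s = ℚΣ.∑-fromTo-ε (suc s) N vanish
    where
    vanish : ∀ t → s < t → t ≤ N → (if not (t ≡ᵇ p) then dependency N p s t else 0ℚ) ≡ 0ℚ
    vanish t s<t t≤N with t ≟ p
    ... | yes refl = if-cong (cong not (≡ᵇ-refl p))
    ... | no t≢p   = trans (if-not-≡ᵇ t≢p)
      (dependency-off-multiples 1≤s s<t t≤N (λ s≡p → p∤s (subst (p ∣_) (sym s≡p) ∣-refl)) t≢p (inj₁ p∤s))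

  dependencySum-multiple : ∀ {j} → 2 ≤ j → j ≤ N / p →
    dependencySum N p (p * j)
      ≡ sumℚ (map (pairContribution N p j) (filterᵇ (λ k → not (divides? j k)) (fromTo (suc j) (N / p))))
  dependencySum-multiple {j} 2≤j j≤M = begin
      dependencySum N p (p * j)
    ≡⟨ ℚΣ.∑-fromTo-multiples p j N j≤M vanish ⟩
      sumℚ (map (term ∘ (p *_)) (fromTo (suc j) (N / p)))
    ≡⟨ ℚΣ.∑-fromTo-cong (suc j) (N / p) (λ k j<k k≤M →
         trans (if-not-≡ᵇ (>⇒≢ (<-trans (m<m*n p j 2≤j) (*-monoʳ-< p j<k))))
               (dependency-multiples 2≤j j<k (≤-trans (*-monoʳ-≤ p k≤M) p*[N/p]≤N))) ⟩
      sumℚ (map (λ k → if not (divides? j k) then pairContribution N p j k else 0ℚ) (fromTo (suc j) (N / p)))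
    ≡⟨ ℚΣ.∑-filterᵇ (pairContribution N p j) _ (fromTo (suc j) (N / p)) ⟨
      sumℚ (map (pairContribution N p j) (filterᵇ (λ k → not (divides? j k)) (fromTo (suc j) (N / p))))
    ∎
    where
    open ≡-Reasoning
    term : ℕ → ℚ
    term t = if not (t ≡ᵇ p) then dependency N p (p * j) t else 0ℚ
    p*[N/p]≤N : p * (N / p) ≤ N
    p*[N/p]≤N = subst (_≤ N) (*-comm (N / p) p) (m/n*n≤m N p)
    1≤pj : 1 ≤ p * j
    1≤pj = ≤-trans (>-nonZero⁻¹ p) (<⇒≤ (m<m*n p j 2≤j))
    vanish : ∀ t → p * j < t → t ≤ N → ¬ p ∣ t → term t ≡ 0ℚ
    vanish t pj<t t≤N p∤t = trans (if-not-≡ᵇ t≢p)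
      (dependency-off-multiples 1≤pj pj<t t≤N (>⇒≢ (m<m*n p j 2≤j)) t≢p (inj₂ p∤t))
      where
      t≢p : t ≢ p
      t≢p t≡p = p∤t (subst (p ∣_) (sym t≡p) ∣-refl)

corollary5 : (N p : ℕ) → 1 ≤ N → Prime p → p ≤ N → betweenness N p ≡ rhs N p
corollary5 N zero      _ p-prime _   = contradiction p-prime ¬prime[0]
corollary5 N p@(suc _) _ p-prime p≤N = begin
    betweenness N p
  ≡⟨ betweenness-as-double-sum N p ⟩
    sumℚ (map row (fromTo 1 N))
  ≡⟨ cong (λ a → sumℚ (map row (fromTo (suc a) N))) (*-zeroʳ p) ⟨
    sumℚ (map row (fromTo (suc (p * 0)) N))
  ≡⟨ ℚΣ.∑-fromTo-multiples p 0 N z≤n (λ s 0<s _ p∤s →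
       trans (if-cong-then (not (s ≡ᵇ p)) (dependencySum-off-multiples p-prime p≤N (≤-trans (s≤s z≤n) 0<s) p∤s))
             (if-eta (not (s ≡ᵇ p)))) ⟩
    sumℚ (map (row ∘ (p *_)) (fromTo 1 (N / p)))
  ≡⟨ cong (sumℚ ∘ map (row ∘ (p *_))) (fromTo-1 (m≥n⇒m/n>0 p≤N)) ⟩
    row (p * 1) ℚ.+ sumℚ (map (row ∘ (p *_)) (fromTo 2 (N / p)))
  ≡⟨ cong₂ ℚ._+_ (if-cong (cong not (trans (cong (_≡ᵇ p) (*-identityʳ p)) (≡ᵇ-refl p))))
                 (ℚΣ.∑-fromTo-cong 2 (N / p) (λ j 2≤j j≤M →
                    trans (if-not-≡ᵇ (>⇒≢ (m<m*n p j 2≤j))) (dependencySum-multiple p-prime p≤N 2≤j j≤M))) ⟩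
    0ℚ ℚ.+ rhs N p
  ≡⟨ ℚP.+-identityˡ _ ⟩
    rhs N p
  ∎
  where
  open ≡-Reasoning
  row : ℕ → ℚ
  row s = if not (s ≡ᵇ p) then dependencySum N p s else 0ℚ
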